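{- For every $n$, $\mathrm{MS}_{\mathrm{sub}}(z_{\mathrm{End}}^{\mathrm{opt}}, n) \le 3$, $\mathrm{MS}_{\mathrm{del}}(z_{\mathrm{End}}^{\mathrm{opt}}, n) \le 3$, and $\mathrm{MS}_{\mathrm{ins}}(z_{\mathrm{End}}^{\mathrm{opt}}, n) \le 2$.
   Context: Strings are finite sequences over an alphabet; $T[i..j]$ is the substring from position $i$ to $j$. An LZ-End factorization of $T$ is a factorization $T = f_1\cdots f_z$ into nonempty phrases where each phrase $f_k$ is either a single character not occurring in $f_1\cdots f_{k-1}$, or has an occurrence $T[i..j] = f_k$ with $j \le |f_1\cdots f_{k-1}|$ and $j = |f_1\cdots f_h|$ for some $1\le h<k$. $z_{\mathrm{End}}^{\mathrm{opt}}(T)$ is the minimum number of phrases of an LZ-End factorization of $T$. For a measure $c$, the worst-case multiplicative sensitivity is $\mathrm{MS}_{\mathrm{edit}}(c,n) = \max\{c(T')/c(T)\}$ over all strings $T$ of length $n$ and all $T'$ obtained from $T$ by a single edit of type $\mathrm{edit}$ (sub: substitution of one character; ins: insertion of one character; del: deletion of one character). -}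

module Defs where

open import Data.Nat using (ℕ; _≤_; _*_; suc)
open import Data.List using (List; []; _∷_; _++_; [_]; concat; take; length)
open import Data.List.Membership.Propositional using (_∈_)
open import Data.Product using (Σ; ∃; _×_; _,_)
open import Relation.Nullary using (¬_)
open import Relation.Binary.PropositionalEquality using (_≡_)

IsSuffix : {A : Set} → List A → List A → Set
IsSuffix {A} f w = Σ (List A) λ u → u ++ f ≡ w

NonEmpty : {A : Set} → List A → Set
NonEmpty {A} f = Σ A λ c → Σ (List A) λ cs → f ≡ c ∷ cs

-- ValidEnd fs : the phrase list fs = f_1 ⋯ f_k satisfies the LZ-End phrase
-- conditions, built phrase by phrase (appending f_{k} to f_1 ⋯ f_{k-1}).
data ValidEnd {A : Set} : List (List A) → Set where
  empty   : ValidEnd []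
  newChar : ∀ {fs} (c : A) → ValidEnd fs → ¬ (c ∈ concat fs) →
            ValidEnd (fs ++ [ [ c ] ])
  -- f_k (nonempty) occurs in T ending at position |f_1 ⋯ f_h| with 1 ≤ h < k,
  -- i.e. f_k is a suffix of f_1 ⋯ f_h
  copy    : ∀ {fs} (f : List A) (h : ℕ) → ValidEnd fs → NonEmpty f →
            1 ≤ h → h ≤ length fs → IsSuffix f (concat (take h fs)) →
            ValidEnd (fs ++ [ f ])

record LZEndFact {A : Set} (T : List A) : Set where
  constructor lzend
  field
    phrases : List (List A)
    valid   : ValidEnd phrases
    covers  : concat phrases ≡ T

open LZEndFact public

IsZEndOpt : {A : Set} → List A → ℕ → Set
IsZEndOpt {A} T k =
  (Σ (LZEndFact T) λ F → length (phrases F) ≡ k) ×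
  (∀ (F : LZEndFact T) → k ≤ length (phrases F))

IsSub : {A : Set} → List A → List A → Set
IsSub {A} T T' = Σ (List A) λ u → Σ (List A) λ v → Σ A λ a → Σ A λ b →
  (T ≡ u ++ a ∷ v) × (T' ≡ u ++ b ∷ v)

IsIns : {A : Set} → List A → List A → Set
IsIns {A} T T' = Σ (List A) λ u → Σ (List A) λ v → Σ A λ b →
  (T ≡ u ++ v) × (T' ≡ u ++ b ∷ v)

IsDel : {A : Set} → List A → List A → Set
IsDel {A} T T' = Σ (List A) λ u → Σ (List A) λ v → Σ A λ a →
  (T ≡ u ++ a ∷ v) × (T' ≡ u ++ v)

MSBound : (Edit : {A : Set} → List A → List A → Set) → ℕ → ℕ → Set₁
MSBound Edit n r = ∀ {A : Set} (T T' : List A) → length T ≡ n → NonEmpty T →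
  Edit T T' → ∀ (k k' : ℕ) → IsZEndOpt T k → IsZEndOpt T' k' → k' ≤ r * k

module Submission where

-- Let T = u α v and T′ = u β v with |α|, |β| ≤ 1, and let F be an LZ-End
-- factorization of T. The phrases of F ending before the edit are kept. The
-- phrase w₁ α w₂ containing the edit is replaced by w₁, written with at most
-- one phrase per earlier phrase (the source of a proper prefix of an LZ-End
-- phrase ends strictly inside an earlier phrase, so recurse on it), then
-- the characters of β, then w₂. Every later phrase copies a suffix of a
-- boundary prefix; it stays a single phrase unless its source crosses α, in
-- which case it is cut into the part before α, the characters of α and the
-- part after α. All boundaries of F survive, shifted past the edit, so the
-- copies stay valid, and the new factorization has at most (2 + |α|)|F|
-- phrases.

open import Defs
open import Data.Nat using (ℕ; suc; _+_; _*_; _≤_; _<_; z≤n; s≤s; _≤?_)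
open import Data.Nat.Properties
open import Data.Nat.Induction using (<-wellFounded)
open import Data.Nat.Solver using (module +-*-Solver)
open import Data.List using (List; []; _∷_; _++_; [_]; concat; take; drop; length; initLast; _∷ʳ′_)
open import Data.List.Properties
  using (++-assoc; ++-identityʳ; ++-cancelˡ; ++-conicalʳ; ∷-injective; ∷ʳ-injective;
         length-++; length-++-≤ˡ; concat-++; take++drop≡id)
open import Data.List.Membership.Propositional using (_∈_)
open import Data.List.Membership.Propositional.Properties using (∈-++⁻; ∈-++⁺ˡ; ∈-++⁺ʳ)
open import Data.List.Relation.Unary.Any using (here; there)
open import Data.Product using (∃; ∃₂; _×_; _,_)
open import Data.Sum using (_⊎_; inj₁; inj₂)
open import Effect.Monad using (RawMonad)
open import Level using (0ℓ)
open import Induction.WellFounded using (Acc; acc)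
open import Relation.Nullary using (¬_; yes; no)
open import Relation.Nullary.Decidable using (decidable-stable; ¬¬-excluded-middle)
open import Relation.Nullary.Negation using (DoubleNegation; ¬¬-Monad)
open import Relation.Unary using (_⊆_)
open import Relation.Binary.PropositionalEquality hiding ([_])

open RawMonad (¬¬-Monad {0ℓ}) using (pure; _>>=_)

take-length-++ : ∀ {A : Set} (as bs : List A) → take (length as) (as ++ bs) ≡ as
take-length-++ []       bs = refl
take-length-++ (a ∷ as) bs = cong (a ∷_) (take-length-++ as bs)

length-∷ʳ : ∀ {A : Set} (xs : List A) x → length (xs ++ [ x ]) ≡ suc (length xs)
length-∷ʳ xs x = trans (length-++ xs) (+-comm (length xs) 1)

module _ {A : Set} where

  ++-≡-++ : ∀ (q w X B : List A) → q ++ w ≡ X ++ B →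
    (∃ λ m → NonEmpty m × X ≡ q ++ m × w ≡ m ++ B) ⊎ (∃ λ m → q ≡ X ++ m × B ≡ m ++ w)
  ++-≡-++ []      w []      B e = inj₂ ([] , refl , sym e)
  ++-≡-++ []      w (x ∷ X) B e = inj₁ (x ∷ X , (x , X , refl) , refl , e)
  ++-≡-++ (y ∷ q) w []      B e = inj₂ (y ∷ q , refl , sym e)
  ++-≡-++ (y ∷ q) w (x ∷ X) B e with refl , e′ ← ∷-injective e with ++-≡-++ q w X B e′
  ... | inj₁ (m , m≢[] , X≡ , w≡) = inj₁ (m , m≢[] , cong (y ∷_) X≡ , w≡)
  ... | inj₂ (m , q≡ , B≡)        = inj₂ (m , cong (y ∷_) q≡ , B≡)

  snoc-≡-++-∷ : ∀ fs (f : List A) xs g ys → fs ++ [ f ] ≡ xs ++ g ∷ ys →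
    (ys ≡ [] × xs ≡ fs × g ≡ f) ⊎ (∃ λ ys′ → fs ≡ xs ++ g ∷ ys′)
  snoc-≡-++-∷ fs f xs g ys e with initLast ys
  ... | [] with fs≡ , f≡ ← ∷ʳ-injective fs xs e = inj₁ (refl , sym fs≡ , sym f≡)
  ... | ys′ ∷ʳ′ y with fs≡ , _ ← ∷ʳ-injective fs (xs ++ g ∷ ys′) (trans e (sym (++-assoc xs (g ∷ ys′) [ y ]))) =
    inj₂ (ys′ , fs≡)

  concat-∷ʳ : ∀ (fs : List (List A)) f → concat (fs ++ [ f ]) ≡ concat fs ++ f
  concat-∷ʳ fs f = trans (sym (concat-++ fs [ f ])) (cong (concat fs ++_) (++-identityʳ f))

  ∈-concat-take : ∀ {c : A} h fs → c ∈ concat (take h fs) → c ∈ concat fs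
  ∈-concat-take {c} h fs c∈ =
    subst (λ gs → c ∈ concat gs) (take++drop≡id h fs)
      (subst (c ∈_) (concat-++ (take h fs) (drop h fs)) (∈-++⁺ˡ c∈))

  prefix-of-singleton : ∀ {c : A} p p₂ → p ++ p₂ ≡ [ c ] → NonEmpty p₂ → p ≡ []
  prefix-of-singleton []           _       _  _           = refl
  prefix-of-singleton (_ ∷ [])     []      _  (_ , _ , ())
  prefix-of-singleton (_ ∷ [])     (_ ∷ _) ()
  prefix-of-singleton (_ ∷ _ ∷ _)  _       ()

  short-prefix : ∀ {α : List A} {v r s} → length α ≤ 1 → α ++ v ≡ r ++ s → NonEmpty r → ∃ λ w → r ≡ α ++ w
  short-prefix {[]}        _          _    _           = _ , refl
  short-prefix {_ ∷ []}    _          refl (_ , _ , refl) = _ , refl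
  short-prefix {_ ∷ _ ∷ _} (s≤s ())   _    _

  nonEmpty-or-[] : ∀ (w : List A) → NonEmpty w ⊎ w ≡ []
  nonEmpty-or-[] []      = inj₂ refl
  nonEmpty-or-[] (c ∷ w) = inj₁ (c , w , refl)

  suffix-refl : ∀ (w : List A) → IsSuffix w w
  suffix-refl w = [] , refl

  suffix-trans : ∀ {w p P : List A} → IsSuffix w p → IsSuffix p P → IsSuffix w P
  suffix-trans {w} (q , refl) (q′ , refl) = q′ ++ q , ++-assoc q′ q w

  suffix-++ˡ : ∀ {w B} (X : List A) → IsSuffix w B → IsSuffix w (X ++ B)
  suffix-++ˡ X (q , refl) = X ++ q , ++-assoc X q _

  suffix-of-[] : ∀ {w : List A} → IsSuffix w [] → w ≡ []
  suffix-of-[] (q , e) = ++-conicalʳ q _ e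

  suffix-length : ∀ {w P : List A} → IsSuffix w P → length w ≤ length P
  suffix-length {w} (q , refl) = subst (length w ≤_) (sym (length-++ q)) (m≤n+m (length w) (length q))

  suffix-++ : ∀ {w} (X B : List A) → IsSuffix w (X ++ B) →
    IsSuffix w B ⊎ (∃ λ x → w ≡ x ++ B × IsSuffix x X)
  suffix-++ X B (q , e) with ++-≡-++ q _ X B e
  ... | inj₁ (m , _ , X≡ , w≡) = inj₂ (m , w≡ , q , sym X≡)
  ... | inj₂ (m , _ , B≡)      = inj₁ (m , sym B≡)

  record PhraseCut (ys : List (List A)) (Q R : List A) : Set where
    constructor phraseCut
    field
      before after : List (List A)
      left right   : List A
      ys≡     : ys ≡ before ++ (left ++ right) ∷ after
      Q≡      : Q ≡ concat before ++ left
      right≢[] : NonEmpty right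
      R≡      : R ≡ right ++ concat after

  cut-phrase : ∀ ys {Q R : List A} → Q ++ R ≡ concat ys → NonEmpty R → PhraseCut ys Q R
  cut-phrase [] {Q} e (c , cs , refl) with () ← ++-conicalʳ Q _ e
  cut-phrase (g ∷ ys) {Q} {R} e R≢[] with ++-≡-++ Q R g (concat ys) e
  ... | inj₁ (m , m≢[] , refl , R≡) = phraseCut [] ys Q m refl refl m≢[] R≡
  ... | inj₂ (m , refl , ys≡) with cut-phrase ys {m} (sym ys≡) R≢[]
  ...   | phraseCut before after left right refl refl right≢[] R≡ =
    phraseCut (g ∷ before) after left right refl (sym (++-assoc g (concat before) left)) right≢[] R≡

  BoundaryPrefix : List (List A) → List A → Set
  BoundaryPrefix gs P = ∃₂ λ as bs → gs ≡ as ++ bs × P ≡ concat as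

  boundary-++ʳ : ∀ {gs P} hs → BoundaryPrefix gs P → BoundaryPrefix (gs ++ hs) P
  boundary-++ʳ hs (as , bs , refl , P≡) = as , bs ++ hs , ++-assoc as bs hs , P≡

  boundary-prefix : ∀ {gs xs} zs → gs ≡ xs ++ zs → BoundaryPrefix xs ⊆ BoundaryPrefix gs
  boundary-prefix zs refl = boundary-++ʳ zs

  boundary-whole : ∀ gs → BoundaryPrefix gs (concat gs)
  boundary-whole gs = gs , [] , sym (++-identityʳ gs) , refl

  boundary-∷ʳ : ∀ zs g {P} → BoundaryPrefix (zs ++ [ g ]) P → BoundaryPrefix zs P ⊎ P ≡ concat (zs ++ [ g ])
  boundary-∷ʳ zs g (as , [] , e , refl) = inj₂ (cong concat (trans (sym (++-identityʳ as)) (sym e)))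
  boundary-∷ʳ zs g (as , b ∷ bs , e , P≡) with snoc-≡-++-∷ zs g as b bs e
  ... | inj₁ (_ , refl , _) = inj₁ (as , [] , sym (++-identityʳ as) , P≡)
  ... | inj₂ (bs′ , zs≡)    = inj₁ (as , b ∷ bs′ , zs≡ , P≡)

  boundary-prefix-of-concat : ∀ {gs P} → BoundaryPrefix gs P → ∃ λ r → P ++ r ≡ concat gs
  boundary-prefix-of-concat (as , bs , refl , refl) = concat bs , concat-++ as bs

  ValidEnd-copy : ∀ {gs f P} → ValidEnd gs → NonEmpty f → BoundaryPrefix gs P → IsSuffix f P →
    ValidEnd (gs ++ [ f ])
  ValidEnd-copy _ (_ , _ , refl) ([] , _ , _ , refl) f⊒[] with () ← suffix-of-[] f⊒[]
  ValidEnd-copy {f = f} v f≢[] (as@(_ ∷ _) , bs , refl , refl) f⊒P =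
    copy f (length as) v f≢[] (s≤s z≤n) (length-++-≤ˡ as)
      (subst (λ xs → IsSuffix f (concat xs)) (sym (take-length-++ as bs)) f⊒P)

  char-ends-boundary : ∀ {gs} {c : A} → ValidEnd gs → c ∈ concat gs →
    ∃ λ P → BoundaryPrefix gs P × IsSuffix [ c ] P
  char-ends-boundary empty ()
  char-ends-boundary {c = c} (newChar {fs} d v _) c∈
    with ∈-++⁻ (concat fs) (subst (c ∈_) (concat-∷ʳ fs [ d ]) c∈)
  ... | inj₂ (here refl) = _ , boundary-whole _ , concat fs , sym (concat-∷ʳ fs [ d ])
  ... | inj₂ (there ())
  ... | inj₁ c∈fs with P , b , c⊒P ← char-ends-boundary v c∈fs = P , boundary-++ʳ _ b , c⊒P
  char-ends-boundary {c = c} (copy {fs} f h v _ _ _ (q , e)) c∈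
    with ∈-++⁻ (concat fs) (subst (c ∈_) (concat-∷ʳ fs f) c∈)
  ... | inj₁ c∈fs with P , b , c⊒P ← char-ends-boundary v c∈fs = P , boundary-++ʳ _ b , c⊒P
  ... | inj₂ c∈f
    with P , b , c⊒P ← char-ends-boundary v (∈-concat-take h fs (subst (c ∈_) e (∈-++⁺ʳ q c∈f))) =
    P , boundary-++ʳ _ b , c⊒P

  -- Whether c already occurs is not decidable over an arbitrary alphabet,
  -- hence the double negation.
  ValidEnd-char : ∀ {gs} (c : A) → ValidEnd gs → DoubleNegation (ValidEnd (gs ++ [ [ c ] ]))
  ValidEnd-char c v = ¬¬-excluded-middle >>= λ where
    (yes c∈) → let P , b , c⊒P = char-ends-boundary v c∈ in pure (ValidEnd-copy v (c , [] , refl) b c⊒P)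
    (no c∉)  → pure (newChar c v c∉)

  ValidPhrase : List (List A) → List A → Set
  ValidPhrase xs f = (∃ λ c → f ≡ [ c ] × ¬ c ∈ concat xs) ⊎
                     (NonEmpty f × ∃ λ P → BoundaryPrefix xs P × IsSuffix f P)

  PhrasewiseValid : List (List A) → Set
  PhrasewiseValid fs = ∀ xs f ys → fs ≡ xs ++ f ∷ ys → ValidPhrase xs f

  PhrasewiseValid-∷ʳ : ∀ {fs f} → PhrasewiseValid fs → ValidPhrase fs f → PhrasewiseValid (fs ++ [ f ])
  PhrasewiseValid-∷ʳ {fs} {f} ok f-ok xs g ys e with snoc-≡-++-∷ fs f xs g ys e
  ... | inj₁ (_ , refl , refl) = f-ok
  ... | inj₂ (ys′ , fs≡)       = ok xs g ys′ fs≡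

  ValidEnd⇒PhrasewiseValid : ∀ {fs} → ValidEnd fs → PhrasewiseValid fs
  ValidEnd⇒PhrasewiseValid empty [] _ _ ()
  ValidEnd⇒PhrasewiseValid empty (_ ∷ _) _ _ ()
  ValidEnd⇒PhrasewiseValid (newChar c v c∉) =
    PhrasewiseValid-∷ʳ (ValidEnd⇒PhrasewiseValid v) (inj₁ (c , refl , c∉))
  ValidEnd⇒PhrasewiseValid (copy {fs} f h v f≢[] _ _ f⊒) =
    PhrasewiseValid-∷ʳ (ValidEnd⇒PhrasewiseValid v)
      (inj₂ (f≢[] , _ , (take h fs , drop h fs , sym (take++drop≡id h fs) , refl) , f⊒))

  PhrasewiseValid-prefix : ∀ {fs} xs ys → fs ≡ xs ++ ys → PhrasewiseValid fs → PhrasewiseValid xs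
  PhrasewiseValid-prefix xs ys refl ok as f bs refl = ok as f (bs ++ ys) (++-assoc as (f ∷ bs) ys)

  ValidEnd-∷ʳ : ∀ {gs f} → ValidEnd gs → ValidPhrase gs f → ValidEnd (gs ++ [ f ])
  ValidEnd-∷ʳ v (inj₁ (c , refl , c∉))        = newChar c v c∉
  ValidEnd-∷ʳ v (inj₂ (f≢[] , _ , b , f⊒P)) = ValidEnd-copy v f≢[] b f⊒P

  PhrasewiseValid⇒ValidEnd : ∀ {fs} → PhrasewiseValid fs → ValidEnd fs
  PhrasewiseValid⇒ValidEnd {fs} = extend [] fs empty
    where
      extend : ∀ gs hs → ValidEnd gs → PhrasewiseValid (gs ++ hs) → ValidEnd (gs ++ hs)
      extend gs []       v _  = subst ValidEnd (sym (++-identityʳ gs)) v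
      extend gs (h ∷ hs) v ok = subst ValidEnd (++-assoc gs [ h ] hs)
        (extend (gs ++ [ h ]) hs (ValidEnd-∷ʳ v (ok gs h hs refl))
          (subst PhrasewiseValid (sym (++-assoc gs [ h ] hs)) ok))

  ValidEnd-prefix : ∀ {fs} xs ys → fs ≡ xs ++ ys → ValidEnd fs → ValidEnd xs
  ValidEnd-prefix xs ys fs≡ v =
    PhrasewiseValid⇒ValidEnd (PhrasewiseValid-prefix xs ys fs≡ (ValidEnd⇒PhrasewiseValid v))

  Appendable : List (List A) → List (List A) → Set
  Appendable xs hs = ∀ {gs} → ValidEnd gs → BoundaryPrefix xs ⊆ BoundaryPrefix gs →
    DoubleNegation (ValidEnd (gs ++ hs))

  record Spelling (xs : List (List A)) (k : ℕ) (w : List A) : Set where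
    constructor spelling
    field
      pieces        : List (List A)
      length-pieces : length pieces ≤ k
      concat-pieces : concat pieces ≡ w
      appendable    : Appendable xs pieces

  spell-[] : ∀ {xs} → Spelling xs 0 []
  spell-[] = spelling [] z≤n refl λ {gs} v _ → pure (subst ValidEnd (sym (++-identityʳ gs)) v)

  spell-++ : ∀ {xs k l w w′} → Spelling xs k w → Spelling xs l w′ → Spelling xs (k + l) (w ++ w′)
  spell-++ {xs} (spelling hs |hs|≤ hs≡ app) (spelling hs′ |hs′|≤ hs′≡ app′) =
    spelling (hs ++ hs′)
      (≤-trans (≤-reflexive (length-++ hs)) (+-mono-≤ |hs|≤ |hs′|≤))
      (trans (sym (concat-++ hs hs′)) (cong₂ _++_ hs≡ hs′≡))
      app″
    where
      app″ : Appendable xs (hs ++ hs′)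
      app″ {gs} v xs⊆gs = do
        v₁ ← app v xs⊆gs
        v₂ ← app′ v₁ (λ b → boundary-++ʳ hs (xs⊆gs b))
        pure (subst ValidEnd (++-assoc gs hs hs′) v₂)

  spell-weaken : ∀ {xs k l w} → k ≤ l → Spelling xs k w → Spelling xs l w
  spell-weaken k≤l (spelling hs |hs|≤ hs≡ app) = spelling hs (≤-trans |hs|≤ k≤l) hs≡ app

  spell-mono : ∀ {xs ys k w} → BoundaryPrefix xs ⊆ BoundaryPrefix ys → Spelling xs k w → Spelling ys k w
  spell-mono xs⊆ys (spelling hs |hs|≤ hs≡ app) =
    spelling hs |hs|≤ hs≡ λ v ys⊆gs → app v (λ b → ys⊆gs (xs⊆ys b))

  spell-suffix : ∀ {xs P w} → BoundaryPrefix xs P → IsSuffix w P → Spelling xs 1 w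
  spell-suffix {w = []}    _ _   = spell-weaken z≤n spell-[]
  spell-suffix {w = c ∷ w} b w⊒P =
    spelling [ c ∷ w ] ≤-refl (++-identityʳ _) λ v xs⊆gs → pure (ValidEnd-copy v (c , w , refl) (xs⊆gs b) w⊒P)

  spell-char : ∀ {xs} (c : A) → Spelling xs 1 [ c ]
  spell-char c = spelling [ [ c ] ] ≤-refl refl λ v _ → ValidEnd-char c v

  spell-chars : ∀ {xs} w → Spelling xs (length w) w
  spell-chars []      = spell-[]
  spell-chars (c ∷ w) = spell-++ (spell-char c) (spell-chars w)

  spell-phrase-suffix : ∀ {xs f w} → ValidPhrase xs f → IsSuffix w f → Spelling xs 1 w
  spell-phrase-suffix {w = w} (inj₁ (c , refl , _)) w⊒f = spell-weaken (suffix-length w⊒f) (spell-chars w)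
  spell-phrase-suffix (inj₂ (_ , _ , b , f⊒P)) w⊒f = spell-suffix b (suffix-trans w⊒f f⊒P)

  -- The source of f ends at a phrase boundary, so the source of p ends
  -- strictly inside an earlier phrase g: w is a suffix of a boundary prefix
  -- followed by a suffix of a proper prefix of g. Recursing on g gives at
  -- most one piece per earlier phrase.
  spell-inside-phrase : ∀ {xs f p p₂ w} → PhrasewiseValid xs → ValidPhrase xs f → f ≡ p ++ p₂ →
    NonEmpty p₂ → IsSuffix w p → Spelling xs (length xs) w
  spell-inside-phrase {xs} = go (<-wellFounded (length xs))
    where
      go : ∀ {xs f p p₂ w} → Acc _<_ (length xs) → PhrasewiseValid xs → ValidPhrase xs f →
        f ≡ p ++ p₂ → NonEmpty p₂ → IsSuffix w p → Spelling xs (length xs) w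
      go {p = p} {p₂} _ _ (inj₁ (_ , f≡[c] , _)) refl p₂≢[] w⊒p
        with refl ← prefix-of-singleton p p₂ f≡[c] p₂≢[] with refl ← suffix-of-[] w⊒p = spell-weaken z≤n spell-[]
      go {xs} {p = p} {p₂} {w} (acc rec) ok (inj₂ (_ , _ , (as , bs , xs≡ , refl) , q , q++f≡)) refl p₂≢[] w⊒p
        with cut-phrase as {q ++ p} (trans (++-assoc q p p₂) q++f≡) p₂≢[]
      ... | phraseCut xs₁ xs₂ r r₂ refl q++p≡ r₂≢[] _ =
        spell-cut (suffix-++ (concat xs₁) r (subst (IsSuffix w) q++p≡ (suffix-++ˡ q w⊒p)))
        where
          xs≡′ : xs ≡ xs₁ ++ (r ++ r₂) ∷ (xs₂ ++ bs)
          xs≡′ = trans xs≡ (++-assoc xs₁ _ bs)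
          shorter : length xs₁ < length xs
          shorter = subst (length xs₁ <_) (sym (trans (cong length xs≡′) (length-++ xs₁))) (m<m+n _ (s≤s z≤n))
          xs₁⊆xs : BoundaryPrefix xs₁ ⊆ BoundaryPrefix xs
          xs₁⊆xs = boundary-prefix _ xs≡′
          spell-r : ∀ {w′} → IsSuffix w′ r → Spelling xs (length xs₁) w′
          spell-r w′⊒r = spell-mono xs₁⊆xs
            (go (rec shorter) (PhrasewiseValid-prefix xs₁ _ xs≡′ ok) (ok xs₁ _ _ xs≡′) refl r₂≢[] w′⊒r)
          spell-cut : IsSuffix w r ⊎ (∃ λ s → w ≡ s ++ r × IsSuffix s (concat xs₁)) → Spelling xs (length xs) w
          spell-cut (inj₁ w⊒r)            = spell-weaken (<⇒≤ shorter) (spell-r w⊒r)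
          spell-cut (inj₂ (s , w≡ , s⊒)) = subst (Spelling xs (length xs)) (sym w≡)
            (spell-weaken shorter (spell-++ (spell-suffix (xs₁⊆xs (boundary-whole xs₁)) s⊒) (spell-r (suffix-refl r))))

open Spelling

module SingleEdit {A : Set} (u α β : List A) where

  EditInvariant : List (List A) → List (List A) → Set
  EditInvariant zs gs = ∀ {P} → BoundaryPrefix zs P →
    (∃ λ r → P ++ r ≡ u × BoundaryPrefix gs P) ⊎
    (∃ λ t → P ≡ u ++ α ++ t × BoundaryPrefix gs (u ++ β ++ t))

  record Edited (zs gs : List (List A)) (t : List A) : Set where
    field
      valid-new  : ValidEnd gs
      concat-old : concat zs ≡ u ++ α ++ t
      concat-new : concat gs ≡ u ++ β ++ t
      boundary-u : BoundaryPrefix gs u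
      boundaries : EditInvariant zs gs
      length-new : length gs ≤ (2 + length α) * length zs

  EditInvariant-prefix : ∀ {xs} hs → (∃ λ r → concat xs ++ r ≡ u) → EditInvariant xs (xs ++ hs)
  EditInvariant-prefix hs (r , xs++r≡u) b with boundary-prefix-of-concat b
  ... | r′ , P++r′≡ = inj₁ (r′ ++ r , trans (sym (++-assoc _ r′ r)) (trans (cong (_++ r) P++r′≡) xs++r≡u) ,
                            boundary-++ʳ hs b)

  EditInvariant-∷ʳ : ∀ {zs gs g hs t} → EditInvariant zs gs →
    concat (zs ++ [ g ]) ≡ u ++ α ++ t → concat (gs ++ hs) ≡ u ++ β ++ t →
    EditInvariant (zs ++ [ g ]) (gs ++ hs)
  EditInvariant-∷ʳ {zs} {gs} {g} {hs} {t} inv old≡ new≡ b with boundary-∷ʳ zs g b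
  ... | inj₂ refl = inj₂ (t , old≡ , subst (BoundaryPrefix (gs ++ hs)) new≡ (boundary-whole _))
  ... | inj₁ b′ with inv b′
  ...   | inj₁ (r , P++r≡u , b″) = inj₁ (r , P++r≡u , boundary-++ʳ hs b″)
  ...   | inj₂ (t′ , P≡ , b″)    = inj₂ (t′ , P≡ , boundary-++ʳ hs b″)

  ++-assoc-tail : ∀ (a t g : List A) → (u ++ a ++ t) ++ g ≡ u ++ a ++ t ++ g
  ++-assoc-tail a t g = trans (++-assoc u (a ++ t) g) (cong (u ++_) (++-assoc a t g))

  spell-edited-phrase : ∀ {zs gs g} → ValidPhrase zs g → EditInvariant zs gs → BoundaryPrefix gs u →
    Spelling gs (2 + length α) g
  spell-edited-phrase (inj₁ (c , refl , _)) _ _ = spell-weaken (s≤s z≤n) (spell-char c)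
  spell-edited-phrase {g = g} (inj₂ (_ , _ , b , g⊒P)) inv bu with inv b
  ... | inj₁ (_ , _ , b′) = spell-weaken (s≤s z≤n) (spell-suffix b′ g⊒P)
  ... | inj₂ (t , refl , b′) with suffix-++ (u ++ α) t (subst (IsSuffix g) (sym (++-assoc u α t)) g⊒P)
  ...   | inj₁ g⊒t = spell-weaken (s≤s z≤n) (spell-suffix b′ (suffix-++ˡ u (suffix-++ˡ β g⊒t)))
  ...   | inj₂ (x , refl , x⊒uα) with suffix-++ u α x⊒uα
  ...     | inj₁ x⊒α = spell-weaken |x|+1≤ (spell-++ (spell-chars x) t-piece)
    where
      |x|+1≤ : length x + 1 ≤ 2 + length α
      |x|+1≤ = ≤-trans (+-monoˡ-≤ 1 (suffix-length x⊒α)) (≤-trans (≤-reflexive (+-comm (length α) 1)) (n≤1+n _))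
      t-piece = spell-suffix b′ (suffix-++ˡ u (suffix-++ˡ β (suffix-refl t)))
  ...     | inj₂ (y , refl , y⊒u) =
    subst (Spelling _ (2 + length α)) (sym (++-assoc y α t))
      (spell-weaken (≤-reflexive (cong suc (+-comm (length α) 1)))
        (spell-++ (spell-suffix bu y⊒u)
          (spell-++ (spell-chars α) (spell-suffix b′ (suffix-++ˡ u (suffix-++ˡ β (suffix-refl t)))))))

  Edited-∷ʳ : ∀ {zs gs g t} → ValidPhrase zs g → Edited zs gs t →
    DoubleNegation (∃ λ hs → Edited (zs ++ [ g ]) (gs ++ hs) (t ++ g))
  Edited-∷ʳ {zs} {gs} {g} {t} g-ok e = do
    v ← appendable sp valid-new (λ b → b)
    pure (hs , record
      { valid-new  = v
      ; concat-old = old≡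
      ; concat-new = new≡
      ; boundary-u = boundary-++ʳ hs boundary-u
      ; boundaries = EditInvariant-∷ʳ boundaries old≡ new≡
      ; length-new = |gs++hs|≤ })
    where
      open Edited e
      r = 2 + length α
      sp = spell-edited-phrase g-ok boundaries boundary-u
      hs = pieces sp
      old≡ : concat (zs ++ [ g ]) ≡ u ++ α ++ t ++ g
      old≡ = trans (concat-∷ʳ zs g) (trans (cong (_++ g) concat-old) (++-assoc-tail α t g))
      new≡ : concat (gs ++ hs) ≡ u ++ β ++ t ++ g
      new≡ = trans (sym (concat-++ gs hs))
               (trans (cong₂ _++_ concat-new (concat-pieces sp)) (++-assoc-tail β t g))
      |gs++hs|≤ : length (gs ++ hs) ≤ r * length (zs ++ [ g ])
      |gs++hs|≤ = begin
        length (gs ++ hs)           ≡⟨ length-++ gs ⟩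
        length gs + length hs       ≤⟨ +-mono-≤ length-new (length-pieces sp) ⟩
        r * length zs + r           ≡⟨ +-comm (r * length zs) r ⟩
        r + r * length zs           ≡⟨ sym (*-suc r (length zs)) ⟩
        r * suc (length zs)         ≡⟨ cong (r *_) (sym (length-∷ʳ zs g)) ⟩
        r * length (zs ++ [ g ])    ∎
        where open ≤-Reasoning

  Edited-++ : ∀ {zs gs t} ys → PhrasewiseValid (zs ++ ys) → Edited zs gs t →
    DoubleNegation (∃ λ gs′ → Edited (zs ++ ys) gs′ (t ++ concat ys))
  Edited-++ {zs} {gs} {t} [] _ e =
    pure (gs , subst₂ (λ zs′ t′ → Edited zs′ gs t′) (sym (++-identityʳ zs)) (sym (++-identityʳ t)) e)
  Edited-++ {zs} {t = t} (g ∷ ys) ok e = do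
    hs , e′ ← Edited-∷ʳ (ok zs g ys refl) e
    gs′ , e″ ← Edited-++ ys (subst PhrasewiseValid (sym (++-assoc zs [ g ] ys)) ok) e′
    pure (gs′ , subst₂ (λ zs′ t′ → Edited zs′ gs′ t′) (++-assoc zs [ g ] ys) (++-assoc t g (concat ys)) e″)

  Edited-start : ∀ {xs f w₁ w₂} → ValidEnd xs → ValidPhrase xs f → u ≡ concat xs ++ w₁ →
    f ≡ w₁ ++ α ++ w₂ → NonEmpty (α ++ w₂) → length β ≤ 1 →
    DoubleNegation (∃ λ gs → Edited (xs ++ [ f ]) gs w₂)
  Edited-start {xs} {f} {w₁} {w₂} v f-ok u≡ f≡ αw₂≢[] |β|≤1 = do
    v₁ ← appendable sp₁ v (λ b → b)
    v₂ ← appendable sp₂ v₁ (λ b → boundary-++ʳ h₁ b)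
    pure ((xs ++ h₁) ++ h₂ , record
      { valid-new  = v₂
      ; concat-old = old≡
      ; concat-new = new≡
      ; boundary-u = boundary-++ʳ h₂ (subst (BoundaryPrefix (xs ++ h₁)) u≡new (boundary-whole _))
      ; boundaries = EditInvariant-∷ʳ (EditInvariant-prefix h₁ (w₁ , sym u≡)) old≡ new≡
      ; length-new = |gs|≤ })
    where
      sp₁ : Spelling xs (length xs) w₁
      sp₁ = spell-inside-phrase (ValidEnd⇒PhrasewiseValid v) f-ok f≡ αw₂≢[] (suffix-refl w₁)
      sp₂ : Spelling xs (length β + 1) (β ++ w₂)
      sp₂ = spell-++ (spell-chars β) (spell-phrase-suffix f-ok (w₁ ++ α , trans (++-assoc w₁ α w₂) (sym f≡)))
      h₁ = pieces sp₁
      h₂ = pieces sp₂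
      u≡new : concat (xs ++ h₁) ≡ u
      u≡new = trans (sym (concat-++ xs h₁)) (trans (cong (concat xs ++_) (concat-pieces sp₁)) (sym u≡))
      old≡ : concat (xs ++ [ f ]) ≡ u ++ α ++ w₂
      old≡ = trans (concat-∷ʳ xs f)
               (trans (cong (concat xs ++_) f≡)
                 (trans (sym (++-assoc (concat xs) w₁ _)) (cong (_++ α ++ w₂) (sym u≡))))
      new≡ : concat ((xs ++ h₁) ++ h₂) ≡ u ++ β ++ w₂
      new≡ = trans (sym (concat-++ (xs ++ h₁) h₂)) (cong₂ _++_ u≡new (concat-pieces sp₂))
      n+n+2≡2*[1+n] : ∀ n → n + n + 2 ≡ 2 * suc n
      n+n+2≡2*[1+n] = +-*-Solver.solve 1 (λ n → n :+ n :+ con 2 := con 2 :* (con 1 :+ n)) refl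
        where open +-*-Solver
      |gs|≤ : length ((xs ++ h₁) ++ h₂) ≤ (2 + length α) * length (xs ++ [ f ])
      |gs|≤ = begin
        length ((xs ++ h₁) ++ h₂)              ≡⟨ trans (length-++ (xs ++ h₁)) (cong (_+ length h₂) (length-++ xs)) ⟩
        length xs + length h₁ + length h₂      ≤⟨ +-mono-≤ (+-monoʳ-≤ (length xs) (length-pieces sp₁))
                                                           (≤-trans (length-pieces sp₂) (+-monoˡ-≤ 1 |β|≤1)) ⟩
        length xs + length xs + 2              ≡⟨ n+n+2≡2*[1+n] (length xs) ⟩
        2 * suc (length xs)                    ≤⟨ *-monoˡ-≤ (suc (length xs)) (m≤m+n 2 (length α)) ⟩
        (2 + length α) * suc (length xs)       ≡⟨ cong ((2 + length α) *_) (sym (length-∷ʳ xs f)) ⟩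
        (2 + length α) * length (xs ++ [ f ])  ∎
        where open ≤-Reasoning

  EditedFactorization : List (List A) → List A → Set
  EditedFactorization fs v =
    ∃ λ gs → ValidEnd gs × concat gs ≡ u ++ β ++ v × length gs ≤ (2 + length α) * length fs

  edit-at-end : ∀ {fs} → ValidEnd fs → concat fs ≡ u → 1 ≤ length fs → length β ≤ 1 →
    DoubleNegation (EditedFactorization fs [])
  edit-at-end {fs} v fs≡u 1≤|fs| |β|≤1 = do
    v′ ← appendable sp v (λ b → b)
    pure (fs ++ pieces sp , v′ , concat≡ , |gs|≤)
    where
      sp = spell-chars {xs = fs} β
      concat≡ : concat (fs ++ pieces sp) ≡ u ++ β ++ []
      concat≡ = trans (sym (concat-++ fs (pieces sp)))
                  (cong₂ _++_ fs≡u (trans (concat-pieces sp) (sym (++-identityʳ β))))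
      |gs|≤ : length (fs ++ pieces sp) ≤ (2 + length α) * length fs
      |gs|≤ = begin
        length (fs ++ pieces sp)       ≡⟨ length-++ fs ⟩
        length fs + length (pieces sp) ≤⟨ +-monoʳ-≤ (length fs) (≤-trans (length-pieces sp) (≤-trans |β|≤1 1≤|fs|)) ⟩
        length fs + length fs          ≡⟨ cong (length fs +_) (sym (+-identityʳ (length fs))) ⟩
        2 * length fs                  ≤⟨ *-monoˡ-≤ (length fs) (m≤m+n 2 (length α)) ⟩
        (2 + length α) * length fs     ∎
        where open ≤-Reasoning

  edit-factorization : ∀ {fs v} → ValidEnd fs → concat fs ≡ u ++ α ++ v → 1 ≤ length fs →
    length α ≤ 1 → length β ≤ 1 → DoubleNegation (EditedFactorization fs v)
  edit-factorization {fs} {v} vf fs≡ 1≤|fs| |α|≤1 |β|≤1 with nonEmpty-or-[] (α ++ v)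
  ... | inj₂ αv≡[] with refl ← ++-conicalʳ α v αv≡[] =
    edit-at-end vf (trans fs≡ (trans (cong (u ++_) αv≡[]) (++-identityʳ u))) 1≤|fs| |β|≤1
  ... | inj₁ αv≢[] with cut-phrase fs (sym fs≡) αv≢[]
  ...   | phraseCut xs ys w₁ r₂ refl u≡ r₂≢[] αv≡ with short-prefix {α = α} |α|≤1 αv≡ r₂≢[]
  ...     | w₂ , refl = do
      _ , e₀ ← Edited-start (ValidEnd-prefix xs _ refl vf) (ok xs _ ys refl) u≡ refl r₂≢[] |β|≤1
      gs , e ← Edited-++ ys (subst PhrasewiseValid (sym (++-assoc xs [ _ ] ys)) ok) e₀
      pure (gs , Edited.valid-new e , trans (Edited.concat-new e) (cong (λ t → u ++ β ++ t) (sym v≡)) ,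
            subst (λ zs → length gs ≤ (2 + length α) * length zs) (++-assoc xs [ _ ] ys) (Edited.length-new e))
    where
      ok = ValidEnd⇒PhrasewiseValid vf
      v≡ : v ≡ w₂ ++ concat ys
      v≡ = ++-cancelˡ α v _ (trans αv≡ (++-assoc α w₂ (concat ys)))

LZEndFact-nonempty : ∀ {A : Set} {T : List A} (F : LZEndFact T) → NonEmpty T → 1 ≤ length (phrases F)
LZEndFact-nonempty (lzend []      _ refl) (_ , _ , ())
LZEndFact-nonempty (lzend (_ ∷ _) _ _)    _ = s≤s z≤n

edit-LZEndFact : ∀ {A : Set} {T : List A} (u α β v : List A) → NonEmpty T → T ≡ u ++ α ++ v →
  length α ≤ 1 → length β ≤ 1 → (F : LZEndFact T) →
  DoubleNegation (∃ λ (G : LZEndFact (u ++ β ++ v)) → length (phrases G) ≤ (2 + length α) * length (phrases F))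
edit-LZEndFact u α β v T≢[] T≡ |α|≤1 |β|≤1 F = do
  gs , vg , gs≡ , |gs|≤ ← SingleEdit.edit-factorization u α β (valid F) (trans (covers F) T≡)
                            (LZEndFact-nonempty F T≢[]) |α|≤1 |β|≤1
  pure (lzend gs vg gs≡ , |gs|≤)

-- Optimality of k′ turns any factorization of T′ into a bound on k′, and the
-- bound is decidable, so it may be established under double negation.
MSBound-intro : ∀ (Edit : {A : Set} → List A → List A → Set) r →
  (∀ {A : Set} {T T′ : List A} → NonEmpty T → Edit T T′ → (F : LZEndFact T) →
    DoubleNegation (∃ λ (G : LZEndFact T′) → length (phrases G) ≤ r * length (phrases F))) →
  ∀ n → MSBound Edit n r
MSBound-intro _ r edit _ _ _ _ T≢[] e k k′ ((F , refl) , _) (_ , k′-opt) =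
  decidable-stable (k′ ≤? r * length (phrases F)) do
    G , |G|≤ ← edit T≢[] e F
    pure (≤-trans (k′-opt G) |G|≤)

corollary1 : ∀ (n : ℕ) → MSBound IsSub n 3 × MSBound IsDel n 3 × MSBound IsIns n 2
corollary1 n =
  MSBound-intro IsSub 3
    (λ { T≢[] (u , v , a , b , T≡ , refl) → edit-LZEndFact u [ a ] [ b ] v T≢[] T≡ ≤-refl ≤-refl }) n ,
  MSBound-intro IsDel 3
    (λ { T≢[] (u , v , a , T≡ , refl) → edit-LZEndFact u [ a ] [] v T≢[] T≡ ≤-refl z≤n }) n ,
  MSBound-intro IsIns 2
    (λ { T≢[] (u , v , b , T≡ , refl) → edit-LZEndFact u [] [ b ] v T≢[] T≡ z≤n ≤-refl }) n
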